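{- Let $P$ be a poset on $\{1,2,\ldots,n\}$. There exists a bijection between the set $\mathscr{F}(P)$ of $P$-forests and the set $\mathscr{M}(G_P)$ of maximum independent sets of the graph $G_P$.
   Context: Let $\leq_P$ be a partial order on $[n]=\{1,\ldots,n\}$. An order ideal of $P$ is a subset $J\subseteq[n]$ such that $i\in J$ and $j\leq_P i$ imply $j\in J$. A (nonempty) order ideal $J$ is connected if the Hasse diagram of $P$ restricted to $J$ is a connected graph. Two sets $A,B$ intersect nontrivially if $A\cap B\neq\emptyset$, $A\not\subseteq B$ and $B\not\subseteq A$. The graph $G_P$ is the simple graph whose vertex set is the set of connected order ideals of $P$, two vertices being adjacent iff they intersect nontrivially. An independent set of a graph is a set of pairwise non-adjacent vertices; a maximum independent set is an independent set of largest possible size. For a poset $F$ on $[n]$ write $\Lambda_i^F=\{j : j\leq_F i\}$. A $P$-forest is a poset $F$ on $[n]$ that is a forest (every element is covered by at most one other element) such that for every $i$, $\Lambda_i^F$ is a connected order ideal of $P$, and for any two elements $i,j$ incomparable in $F$, the set $\Lambda_i^F\cup\Lambda_j^F$ is a disconnected order ideal of $P$. -}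

module Defs where

open import Level using (0ℓ)
open import Data.Bool using (Bool; true; false; T)
open import Data.Nat using (ℕ; zero; suc; _≤_)
open import Data.Fin using (Fin)
open import Data.Fin.Subset using (Subset; _∈_; _∉_; _⊆_; _∪_; _∩_; Nonempty)
open import Data.Vec using (Vec; []; _∷_; tabulate)
open import Data.List using (List; []; _∷_; map; _++_; filter; length)
open import Data.Product using (Σ; ∃; _×_; _,_; proj₁)
open import Data.Sum using (_⊎_)
open import Relation.Nullary using (¬_)
open import Relation.Binary using (Setoid)
open import Relation.Binary.PropositionalEquality using (_≡_; refl; sym; trans)
open import Relation.Unary using () renaming (Decidable to DecidableP)
open import Data.Bool.Properties using (T?)
open import Function.Bundles using (Bijection)

record IsPartialOrderB {n : ℕ} (le : Fin n → Fin n → Bool) : Set where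
  field
    reflB    : ∀ i → T (le i i)
    antisymB : ∀ i j → T (le i j) → T (le j i) → i ≡ j
    transB   : ∀ i j k → T (le i j) → T (le j k) → T (le i k)

record Poset (n : ℕ) : Set where
  field
    le      : Fin n → Fin n → Bool
    isPO    : IsPartialOrderB le

module _ {n : ℕ} where

  _≤[_]_ : Fin n → (Fin n → Fin n → Bool) → Fin n → Set
  i ≤[ r ] j = T (r i j)

  _<[_]_ : Fin n → (Fin n → Fin n → Bool) → Fin n → Set
  i <[ r ] j = i ≤[ r ] j × ¬ (i ≡ j)

  _⋖[_]_ : Fin n → (Fin n → Fin n → Bool) → Fin n → Set
  i ⋖[ r ] j = i <[ r ] j × (∀ k → ¬ (i <[ r ] k × k <[ r ] j))

  IsOrderIdeal : Poset n → Subset n → Set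
  IsOrderIdeal P J = ∀ i j → i ∈ J → j ≤[ Poset.le P ] i → j ∈ J

  -- i and j joined by a path inside J in the Hasse diagram of P
  -- (edges = cover relations of P, in either direction)
  data PathIn (P : Poset n) (J : Subset n) (i : Fin n) : Fin n → Set where
    here : i ∈ J → PathIn P J i i
    step : ∀ {k j} → PathIn P J i k → j ∈ J →
           (k ⋖[ Poset.le P ] j ⊎ j ⋖[ Poset.le P ] k) → PathIn P J i j

  IsConnectedSet : Poset n → Subset n → Set
  IsConnectedSet P J = Nonempty J × (∀ i j → i ∈ J → j ∈ J → PathIn P J i j)

  IsConnIdeal : Poset n → Subset n → Set
  IsConnIdeal P J = IsOrderIdeal P J × IsConnectedSet P J

  IsDisconnIdeal : Poset n → Subset n → Set
  IsDisconnIdeal P J = IsOrderIdeal P J × ¬ IsConnectedSet P J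

  IntersectNontrivially : Subset n → Subset n → Set
  IntersectNontrivially A B = Nonempty (A ∩ B) × ¬ (A ⊆ B) × ¬ (B ⊆ A)

allSubsets : (n : ℕ) → List (Subset n)
allSubsets zero    = [] ∷ []
allSubsets (suc n) = map (true ∷_) (allSubsets n) ++ map (false ∷_) (allSubsets n)

module _ {n : ℕ} where

  -- A set of vertices of G_P: a (Boolean) indicator on subsets of [n]
  -- whose members are all connected order ideals of P.
  VertexSet : Poset n → Set
  VertexSet P = Σ (Subset n → Bool) λ S → ∀ J → T (S J) → IsConnIdeal P J

  card : (Subset n → Bool) → ℕ
  card S = length (filter (λ J → T? (S J)) (allSubsets n))

  IsIndependent : (P : Poset n) → VertexSet P → Set
  IsIndependent P (S , _) =
    ∀ A B → T (S A) → T (S B) → ¬ IntersectNontrivially A B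

  IsMaximumIndependent : (P : Poset n) → VertexSet P → Set
  IsMaximumIndependent P S =
    IsIndependent P S ×
    (∀ (S' : VertexSet P) → IsIndependent P S' → card (proj₁ S') ≤ card (proj₁ S))

  MaxIndepSetoid : Poset n → Setoid 0ℓ 0ℓ
  MaxIndepSetoid P = record
    { Carrier       = Σ (VertexSet P) (IsMaximumIndependent P)
    ; _≈_           = λ x y → ∀ J → proj₁ (proj₁ x) J ≡ proj₁ (proj₁ y) J
    ; isEquivalence = record
      { refl  = λ _ → refl
      ; sym   = λ p J → sym (p J)
      ; trans = λ p q J → trans (p J) (q J) } }

  Λ : (Fin n → Fin n → Bool) → Fin n → Subset n
  Λ F i = tabulate (λ j → F j i)

  IsPForest : Poset n → (Fin n → Fin n → Bool) → Set
  IsPForest P F =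
    IsPartialOrderB F ×
    -- forest: every element is covered by at most one element
    (∀ i j k → i ⋖[ F ] j → i ⋖[ F ] k → j ≡ k) ×
    (∀ i → IsConnIdeal P (Λ F i)) ×
    (∀ i j → ¬ (i ≤[ F ] j) → ¬ (j ≤[ F ] i) →
       IsDisconnIdeal P (Λ F i ∪ Λ F j))

  PForestSetoid : Poset n → Setoid 0ℓ 0ℓ
  PForestSetoid P = record
    { Carrier       = Σ (Fin n → Fin n → Bool) (IsPForest P)
    ; _≈_           = λ x y → ∀ i j → proj₁ x i j ≡ proj₁ y i j
    ; isEquivalence = record
      { refl  = λ _ _ → refl
      ; sym   = λ p i j → sym (p i j)
      ; trans = λ p q i j → trans (p i j) (q i j) } }

-- An independent set of G_P is a laminar family of connected order ideals. Call x a
-- new element of a member J if x ∈ J lies in no smaller member. Every member has one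
-- (otherwise a largest proper submember and the members disjoint from it would split
-- J into two disjoint order ideals), and distinct members have distinct ones, so
-- independent sets have at most n members. The family { Λ_i^F } of a P-forest F is
-- independent with n members, and an independent set with n members exists for every
-- P (recursively add the component of a maximal element), so the maximum independent
-- sets are those with n members. In such a set every i is the new element of exactly
-- one member L_i, and L_i ⊆ L_j defines the inverse P-forest; since i is the new
-- element of Λ_i^F, the family { Λ_i^F } also determines F.

module Submission where

open import Defs
open import Data.Bool using (Bool; true; false; T; _∨_)
open import Data.Bool.Properties using (T?; T-∨; T-irrelevant) renaming (_≟_ to _≟ᵇ_)
open import Data.Empty using (⊥-elim)
open import Data.Fin using (Fin; zero; suc; punchOut) renaming (_≟_ to _≟ᶠ_)
open import Data.Fin.Properties using (any?; all?; injective⇒≤; punchOut-injective)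
open import Data.Fin.Subset
  using (Subset; _∈_; _∉_; _⊆_; _⊂_; _∪_; _∩_; Nonempty; ∣_∣; ⁅_⁆; ⊤)
open import Data.Fin.Subset.Properties
  using ( _∈?_; _⊆?_; nonempty?; anySubset?; ⊆-refl; ⊆-reflexive; ⊆-trans; ⊆-antisym; ∈⊤
        ; x∈p∪q⁺; x∈p∪q⁻; x∈p∩q⁺; x∈p∩q⁻; p⊆p∪q; x∈⁅x⁆; x∈⁅y⁆⇒x≡y; ∣⁅x⁆∣≡1
        ; _⊂?_; p⊂q⇒∣p∣<∣q∣; ∣p∣≤n)
open import Data.List using (List; []; _∷_; map; filter; length; lookup; allFin)
open import Data.List.Membership.Propositional using () renaming (_∈_ to _∈ˡ_)
open import Data.List.Membership.Propositional.Properties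
  using (∈-filter⁺; ∈-filter⁻; ∈-map⁺; ∈-map⁻; ∈-++⁺ˡ; ∈-++⁺ʳ; ∈-lookup; ∈-allFin)
open import Data.List.Relation.Unary.All as All using ([])
open import Data.List.Relation.Unary.All.Properties using (all-filter)
open import Data.List.Relation.Unary.Any as Any using (here; there)
open import Data.List.Relation.Unary.Any.Properties using (lookup-index)
open import Data.List.Relation.Unary.AllPairs using ([]; _∷_)
open import Data.List.Relation.Unary.Unique.Propositional using (Unique)
import Data.List.Relation.Unary.Unique.Propositional.Properties as Unique
open import Data.Nat using (ℕ; zero; suc; _≤_; _<_; s≤s)
open import Data.Nat.Properties
  using (≤-refl; ≤-reflexive; ≤-trans; <-≤-trans; ≤-pred; <⇒≱; ≤-totalOrder)
open import Data.List.Extrema ≤-totalOrder using (argmax; argmax-all; f[xs]≤f[argmax])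
open import Data.Product using (Σ; ∃; _×_; _,_; proj₁; proj₂)
open import Data.Sum using (_⊎_; inj₁; inj₂; swap)
open import Data.Vec using ([]; _∷_; tabulate)
open import Data.Vec.Properties using (≡-dec; lookup∘tabulate; []=⇒lookup; lookup⇒[]=; tabulate-cong)
open import Function.Base using (_∘_)
open import Function.Bundles using (Bijection; Equivalence)
open import Relation.Binary.PropositionalEquality
  using (_≡_; _≢_; refl; sym; trans; cong; cong₂; subst; module ≡-Reasoning)
open import Relation.Nullary using (¬_; Dec; yes; no)
open import Relation.Nullary.Decidable using (⌊_⌋; toWitness; fromWitness; _×-dec_; _⊎-dec_; ¬?)

T-injective : {a b : Bool} → (T a → T b) → (T b → T a) → a ≡ b
T-injective {false} {false} _ _ = refl
T-injective {false} {true}  _ g = ⊥-elim (g _)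
T-injective {true}  {false} f _ = ⊥-elim (f _)
T-injective {true}  {true}  _ _ = refl

module _ {n : ℕ} where

  ∈-tabulate⁺ : (f : Fin n → Bool) {x : Fin n} → T (f x) → x ∈ tabulate f
  ∈-tabulate⁺ f {x} t = lookup⇒[]= x (tabulate f) (trans (lookup∘tabulate f x) (T-true t))
    where
    T-true : ∀ {b} → T b → b ≡ true
    T-true {true} _ = refl

  ∈-tabulate⁻ : (f : Fin n → Bool) {x : Fin n} → x ∈ tabulate f → T (f x)
  ∈-tabulate⁻ f {x} x∈ = subst T (trans (sym ([]=⇒lookup x∈)) (lookup∘tabulate f x)) _

  select : {Q : Fin n → Set} → (∀ x → Dec (Q x)) → Subset n
  select Q? = tabulate (λ x → ⌊ Q? x ⌋)

  ∈-select⁺ : {Q : Fin n → Set} (Q? : ∀ x → Dec (Q x)) {x : Fin n} → Q x → x ∈ select Q?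
  ∈-select⁺ Q? {x} q = ∈-tabulate⁺ (λ y → ⌊ Q? y ⌋) (fromWitness {a? = Q? x} q)

  ∈-select⁻ : {Q : Fin n → Set} (Q? : ∀ x → Dec (Q x)) {x : Fin n} → x ∈ select Q? → Q x
  ∈-select⁻ Q? x∈ = toWitness (∈-tabulate⁻ _ x∈)

  _≟ˢ_ : (p q : Subset n) → Dec (p ≡ q)
  _≟ˢ_ = ≡-dec _≟ᵇ_

  ⊈⇒∃∉ : {p q : Subset n} → ¬ (p ⊆ q) → ∃ λ x → x ∈ p × x ∉ q
  ⊈⇒∃∉ {p} {q} p⊈q with any? (λ x → (x ∈? p) ×-dec ¬? (x ∈? q))
  ... | yes w = w
  ... | no ∄ = ⊥-elim (p⊈q λ {x} x∈p → decidable-stable x x∈p)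
    where
    decidable-stable : ∀ x → x ∈ p → x ∈ q
    decidable-stable x x∈p with x ∈? q
    ... | yes x∈q = x∈q
    ... | no x∉q = ⊥-elim (∄ (x , x∈p , x∉q))

  Disjoint : Subset n → Subset n → Set
  Disjoint p q = ∀ x → x ∈ p → x ∉ q

  ⊆⇒≡⊎⊂ : {p q : Subset n} → p ⊆ q → p ≡ q ⊎ p ⊂ q
  ⊆⇒≡⊎⊂ {p} {q} p⊆q with q ⊆? p
  ... | yes q⊆p = inj₁ (⊆-antisym p⊆q q⊆p)
  ... | no q⊈p = inj₂ (p⊆q , ⊈⇒∃∉ q⊈p)

module _ {A : Set} (xs : List A) (complete : ∀ x → x ∈ˡ xs) where

  argmax-over : {Q : A → Set} → (∀ x → Dec (Q x)) → (f : A → ℕ) → ∃ Q →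
                ∃ λ a → Q a × (∀ y → Q y → f y ≤ f a)
  argmax-over Q? f (x , qx) = a , argmax-all f qx (all-filter Q? xs) , maximal
    where
    a = argmax f x (filter Q? xs)
    maximal : ∀ y → _ → f y ≤ f a
    maximal y qy = All.lookup (f[xs]≤f[argmax] x (filter Q? xs)) (∈-filter⁺ Q? (complete y) qy)

allSubsets-complete : ∀ {n} (p : Subset n) → p ∈ˡ allSubsets n
allSubsets-complete []           = here refl
allSubsets-complete (true ∷ p)  = ∈-++⁺ˡ (∈-map⁺ (true ∷_) (allSubsets-complete p))
allSubsets-complete {suc n} (false ∷ p) =
  ∈-++⁺ʳ (map (true ∷_) (allSubsets n)) (∈-map⁺ (false ∷_) (allSubsets-complete p))

allSubsets-unique : ∀ n → Unique (allSubsets n)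
allSubsets-unique zero    = [] ∷ []
allSubsets-unique (suc n) =
  Unique.++⁺ (Unique.map⁺ ∷-injectiveʳ (allSubsets-unique n))
             (Unique.map⁺ ∷-injectiveʳ (allSubsets-unique n)) heads-differ
  where
  ∷-injectiveʳ : ∀ {b} {p q : Subset n} → b ∷ p ≡ b ∷ q → p ≡ q
  ∷-injectiveʳ refl = refl
  heads-differ : ∀ {p} → ¬ (p ∈ˡ map (true ∷_) (allSubsets n) × p ∈ˡ map (false ∷_) (allSubsets n))
  heads-differ (p∈ , q∈) with ∈-map⁻ (true ∷_) p∈ | ∈-map⁻ (false ∷_) q∈
  ... | _ , _ , refl | _ , _ , ()

lookup-injective : {A : Set} {xs : List A} → Unique xs → ∀ i j → lookup xs i ≡ lookup xs j → i ≡ j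
lookup-injective (_ ∷ _)  zero    zero    _ = refl
lookup-injective (x∉ ∷ _) zero    (suc j) e = ⊥-elim (All.lookup x∉ (∈-lookup j) e)
lookup-injective (x∉ ∷ _) (suc i) zero    e = ⊥-elim (All.lookup x∉ (∈-lookup i) (sym e))
lookup-injective (_ ∷ u)  (suc i) (suc j) e = cong suc (lookup-injective u i j e)

module _ {n : ℕ} (S : Subset n → Bool) where

  members : List (Subset n)
  members = filter (λ J → T? (S J)) (allSubsets n)

  members-unique : Unique members
  members-unique = Unique.filter⁺ (λ J → T? (S J)) (allSubsets-unique n)

  ∈-members⁺ : ∀ {J} → T (S J) → J ∈ˡ members
  ∈-members⁺ {J} = ∈-filter⁺ (λ J → T? (S J)) (allSubsets-complete J)

  ∈-members⁻ : ∀ {J} → J ∈ˡ members → T (S J)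
  ∈-members⁻ J∈ = proj₂ (∈-filter⁻ (λ J → T? (S J)) {xs = allSubsets n} J∈)

  card-injective-≤ : ∀ {m} (f : ∀ J → T (S J) → Fin m) →
                     (∀ J K s t → f J s ≡ f K t → J ≡ K) → card S ≤ m
  card-injective-≤ f f-inj = injective⇒≤ {f = g} g-inj
    where
    g : Fin (length members) → Fin _
    g i = f (lookup members i) (∈-members⁻ (∈-lookup i))
    g-inj : ∀ {i j} → g i ≡ g j → i ≡ j
    g-inj {i} {j} e = lookup-injective members-unique i j (f-inj _ _ _ _ e)

  injective-≤-card : ∀ {m} (h : Fin m → Subset n) → (∀ i → T (S (h i))) →
                     (∀ i j → h i ≡ h j → i ≡ j) → m ≤ card S
  injective-≤-card h h∈ h-inj = injective⇒≤ {f = g} g-inj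
    where
    g : Fin _ → Fin (length members)
    g i = Any.index (∈-members⁺ (h∈ i))
    lookup-g : ∀ i → h i ≡ lookup members (g i)
    lookup-g i = lookup-index (∈-members⁺ (h∈ i))
    g-inj : ∀ {i j} → g i ≡ g j → i ≡ j
    g-inj {i} {j} e = h-inj i j (trans (lookup-g i) (trans (cong (lookup members) e) (sym (lookup-g j))))

  card-injective-< : ∀ {m} (x : Fin m) (f : ∀ J → T (S J) → Fin m) →
                     (∀ J K s t → f J s ≡ f K t → J ≡ K) → (∀ J s → f J s ≢ x) → card S < m
  card-injective-< {suc m} x f f-inj f≢x =
    s≤s (card-injective-≤ (λ J s → punchOut (x≢f J s))
          λ J K s t e → f-inj J K s t (punchOut-injective (x≢f J s) (x≢f K t) e))
    where
    x≢f : ∀ J s → x ≢ f J s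
    x≢f J s e = f≢x J s (sym e)

module Hasse {n : ℕ} (P : Poset n) where

  open Poset P using (le)

  DownClosed : (Fin n → Set) → Set
  DownClosed A = ∀ i j → A i → j ≤[ le ] i → A j

  path-end : ∀ {J i j} → PathIn P J i j → j ∈ J
  path-end (here j∈)     = j∈
  path-end (step _ j∈ _) = j∈

  path-mono : ∀ {J K i j} → J ⊆ K → PathIn P J i j → PathIn P K i j
  path-mono J⊆K (here i∈)      = here (J⊆K i∈)
  path-mono J⊆K (step p j∈ e) = step (path-mono J⊆K p) (J⊆K j∈) e

  infixr 5 _++ᵖ_
  _++ᵖ_ : ∀ {J i k j} → PathIn P J i k → PathIn P J k j → PathIn P J i j
  p ++ᵖ here _       = p
  p ++ᵖ step q j∈ e = step (p ++ᵖ q) j∈ e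

  path-reverse : ∀ {J i j} → PathIn P J i j → PathIn P J j i
  path-reverse (here i∈)      = here i∈
  path-reverse (step p j∈ e) = step (here j∈) (path-end p) (swap e) ++ᵖ path-reverse p

  -- Going down an edge stays in a down-closed set; going up from A lands in A
  -- or B, and B is excluded because its down-closure would then meet A.
  path-stays : {A B : Fin n → Set} → DownClosed A → DownClosed B → (∀ x → A x → ¬ B x) →
               ∀ {J} → (∀ x → x ∈ J → A x ⊎ B x) → ∀ {i j} → A i → PathIn P J i j → A j
  path-stays dA dB A∩B=∅ J⊆A∪B Ai (here _) = Ai
  path-stays dA dB A∩B=∅ J⊆A∪B Ai (step {k} {j} p _ (inj₂ j⋖k)) =
    dA k j (path-stays dA dB A∩B=∅ J⊆A∪B Ai p) (proj₁ (proj₁ j⋖k))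
  path-stays dA dB A∩B=∅ J⊆A∪B Ai (step {k} {j} p j∈ (inj₁ k⋖j)) with J⊆A∪B j j∈
  ... | inj₁ Aj = Aj
  ... | inj₂ Bj = ⊥-elim (A∩B=∅ k (path-stays dA dB A∩B=∅ J⊆A∪B Ai p) (dB j k Bj (proj₁ (proj₁ k⋖j))))

  disjoint-ideals-disconnected : ∀ A B → IsOrderIdeal P A → IsOrderIdeal P B →
    Disjoint A B → Nonempty A → Nonempty B → ¬ IsConnectedSet P (A ∪ B)
  disjoint-ideals-disconnected A B iA iB A∩B=∅ (a , a∈) (b , b∈) (_ , connected) =
    A∩B=∅ b (path-stays iA iB A∩B=∅ (λ x → x∈p∪q⁻ A B) a∈ path) b∈
    where
    path = connected a b (x∈p∪q⁺ (inj₁ a∈)) (x∈p∪q⁺ (inj₂ b∈))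

  ∪-ideal : ∀ A B → IsOrderIdeal P A → IsOrderIdeal P B → IsOrderIdeal P (A ∪ B)
  ∪-ideal A B iA iB i j i∈ j≤i with x∈p∪q⁻ A B i∈
  ... | inj₁ i∈A = x∈p∪q⁺ (inj₁ (iA i j i∈A j≤i))
  ... | inj₂ i∈B = x∈p∪q⁺ (inj₂ (iB i j i∈B j≤i))

  ∪-connected : ∀ A B k → IsConnectedSet P A → IsConnectedSet P B → k ∈ A → k ∈ B →
                IsConnectedSet P (A ∪ B)
  ∪-connected A B k ((a , a∈) , cA) (_ , cB) k∈A k∈B = (a , x∈p∪q⁺ (inj₁ a∈)) , connected
    where
    to-k : ∀ x → x ∈ A ∪ B → PathIn P (A ∪ B) x k
    to-k x x∈ with x∈p∪q⁻ A B x∈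
    ... | inj₁ x∈A = path-mono (p⊆p∪q B) (cA x k x∈A k∈A)
    ... | inj₂ x∈B = path-mono (λ z → x∈p∪q⁺ (inj₂ z)) (cB x k x∈B k∈B)
    connected : ∀ i j → i ∈ A ∪ B → j ∈ A ∪ B → PathIn P (A ∪ B) i j
    connected i j i∈ j∈ = to-k i i∈ ++ᵖ path-reverse (to-k j j∈)

module Laminar {n : ℕ} (P : Poset n) (V : VertexSet P) (indep : IsIndependent P V) where

  open Hasse P

  S : Subset n → Bool
  S = proj₁ V

  member-conn-ideal : ∀ J → T (S J) → IsConnIdeal P J
  member-conn-ideal = proj₂ V

  laminar : ∀ A B → T (S A) → T (S B) → Disjoint A B ⊎ A ⊆ B ⊎ B ⊆ A
  laminar A B A∈ B∈ with nonempty? (A ∩ B) | A ⊆? B | B ⊆? A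
  ... | no A∩B=∅ | _ | _ = inj₁ λ x x∈A x∈B → A∩B=∅ (x , x∈p∩q⁺ (x∈A , x∈B))
  ... | yes _ | yes A⊆B | _ = inj₂ (inj₁ A⊆B)
  ... | yes _ | no _ | yes B⊆A = inj₂ (inj₂ B⊆A)
  ... | yes meet | no A⊈B | no B⊈A = ⊥-elim (indep A B A∈ B∈ (meet , A⊈B , B⊈A))

  ProperSubmember : Subset n → Subset n → Set
  ProperSubmember J K = T (S K) × K ⊂ J

  CoveredIn : Subset n → Fin n → Set
  CoveredIn J x = ∃ λ K → ProperSubmember J K × x ∈ K

  covered? : ∀ J x → Dec (CoveredIn J x)
  covered? J x = anySubset? (λ K → (T? (S K) ×-dec (K ⊂? J)) ×-dec (x ∈? K))

  NewIn : Fin n → Subset n → Set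
  NewIn x J = x ∈ J × ¬ CoveredIn J x

  member-not-covered : ∀ J → T (S J) → ¬ (∀ x → x ∈ J → CoveredIn J x)
  member-not-covered J J∈ cover with member-conn-ideal J J∈
  ... | _ , (x₀ , x₀∈J) , J-connected with cover x₀ x₀∈J
  ... | K₀ , K₀-sub , _
    with argmax-over (allSubsets n) allSubsets-complete (λ K → T? (S K) ×-dec (K ⊂? J)) ∣_∣ (K₀ , K₀-sub)
  ... | A , (A∈ , A⊆J , y , y∈J , y∉A) , largest with member-conn-ideal A A∈
  ... | A-ideal , (a , a∈A) , _ =
    y∉A (path-stays A-ideal inOther A∩Other=∅ J⊆A∪Other a∈A (J-connected a y (A⊆J a∈A) y∈J))
    where
    InOther : Fin n → Set
    InOther x = ∃ λ K → ProperSubmember J K × Disjoint K A × x ∈ K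
    inside-or-disjoint : ∀ K → ProperSubmember J K → K ⊆ A ⊎ Disjoint K A
    inside-or-disjoint K sub@(K∈ , _) with laminar K A K∈ A∈
    ... | inj₁ K∩A=∅ = inj₂ K∩A=∅
    ... | inj₂ (inj₁ K⊆A) = inj₁ K⊆A
    ... | inj₂ (inj₂ A⊆K) with ⊆⇒≡⊎⊂ A⊆K
    ...   | inj₁ refl = inj₁ ⊆-refl
    ...   | inj₂ A⊂K = ⊥-elim (<⇒≱ (p⊂q⇒∣p∣<∣q∣ A⊂K) (largest K sub))
    J⊆A∪Other : ∀ x → x ∈ J → x ∈ A ⊎ InOther x
    J⊆A∪Other x x∈J with cover x x∈J
    ... | K , sub , x∈K with inside-or-disjoint K sub
    ...   | inj₁ K⊆A = inj₁ (K⊆A x∈K)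
    ...   | inj₂ K∩A=∅ = inj₂ (K , sub , K∩A=∅ , x∈K)
    inOther : DownClosed InOther
    inOther i j (K , sub , K∩A=∅ , i∈K) j≤i =
      K , sub , K∩A=∅ , proj₁ (member-conn-ideal K (proj₁ sub)) i j i∈K j≤i
    A∩Other=∅ : ∀ x → x ∈ A → ¬ InOther x
    A∩Other=∅ x x∈A (K , _ , K∩A=∅ , x∈K) = K∩A=∅ x x∈K x∈A

  new-exists : ∀ J → T (S J) → ∃ λ x → NewIn x J
  new-exists J J∈ with any? (λ x → (x ∈? J) ×-dec ¬? (covered? J x))
  ... | yes new = new
  ... | no ∄new = ⊥-elim (member-not-covered J J∈ cover)
    where
    cover : ∀ x → x ∈ J → CoveredIn J x
    cover x x∈J with covered? J x
    ... | yes c = c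
    ... | no ¬c = ⊥-elim (∄new (x , x∈J , ¬c))

  new-unique : ∀ x J K → T (S J) → T (S K) → NewIn x J → NewIn x K → J ≡ K
  new-unique x J K J∈ K∈ (x∈J , newJ) (x∈K , newK) with laminar J K J∈ K∈
  ... | inj₁ J∩K=∅ = ⊥-elim (J∩K=∅ x x∈J x∈K)
  ... | inj₂ (inj₁ J⊆K) with ⊆⇒≡⊎⊂ J⊆K
  ...   | inj₁ J≡K = J≡K
  ...   | inj₂ J⊂K = ⊥-elim (newK (J , (J∈ , J⊂K) , x∈J))
  new-unique x J K J∈ K∈ (x∈J , newJ) (x∈K , newK) | inj₂ (inj₂ K⊆J) with ⊆⇒≡⊎⊂ K⊆J
  ...   | inj₁ K≡J = sym K≡J
  ...   | inj₂ K⊂J = ⊥-elim (newJ (K , (K∈ , K⊂J) , x∈K))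

  new : ∀ J → T (S J) → Fin n
  new J J∈ = proj₁ (new-exists J J∈)

  new-injective : ∀ J K J∈ K∈ → new J J∈ ≡ new K K∈ → J ≡ K
  new-injective J K J∈ K∈ e =
    new-unique _ J K J∈ K∈ (proj₂ (new-exists J J∈))
               (subst (λ x → NewIn x K) (sym e) (proj₂ (new-exists K K∈)))

  card≤n : card S ≤ n
  card≤n = card-injective-≤ S new new-injective

module _ {n : ℕ} (F : Fin n → Fin n → Bool) where

  ∈-Λ⁺ : ∀ {i j} → j ≤[ F ] i → j ∈ Λ F i
  ∈-Λ⁺ = ∈-tabulate⁺ (λ j → F j _)

  ∈-Λ⁻ : ∀ {i j} → j ∈ Λ F i → j ≤[ F ] i
  ∈-Λ⁻ = ∈-tabulate⁻ (λ j → F j _)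

  ΛFamily : Subset n → Bool
  ΛFamily J = ⌊ any? (λ i → Λ F i ≟ˢ J) ⌋

  ∈-ΛFamily⁺ : ∀ i → T (ΛFamily (Λ F i))
  ∈-ΛFamily⁺ i = fromWitness (i , refl)

  ∈-ΛFamily⁻ : ∀ {J} → T (ΛFamily J) → ∃ λ i → Λ F i ≡ J
  ∈-ΛFamily⁻ = toWitness

ΛFamily-cong : ∀ {n} {F G : Fin n → Fin n → Bool} → (∀ i j → F i j ≡ G i j) →
               ∀ J → ΛFamily F J ≡ ΛFamily G J
ΛFamily-cong {F = F} {G} F≗G J = T-injective (transfer F≗G) (transfer λ i j → sym (F≗G i j))
  where
  transfer : ∀ {F G} → (∀ i j → F i j ≡ G i j) → T (ΛFamily F J) → T (ΛFamily G J)
  transfer {F} {G} F≗G J∈ with ∈-ΛFamily⁻ F J∈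
  ... | i , refl = subst (T ∘ ΛFamily G) (tabulate-cong (λ j → sym (F≗G j i))) (∈-ΛFamily⁺ G i)

module Forest {n : ℕ} (P : Poset n) (F : Fin n → Fin n → Bool) (F-forest : IsPForest P F) where

  open Hasse P
  open IsPartialOrderB (proj₁ F-forest)

  Λ-conn-ideal : ∀ i → IsConnIdeal P (Λ F i)
  Λ-conn-ideal = proj₁ (proj₂ (proj₂ F-forest))

  incomparable-disconnected : ∀ i j → ¬ i ≤[ F ] j → ¬ j ≤[ F ] i → IsDisconnIdeal P (Λ F i ∪ Λ F j)
  incomparable-disconnected = proj₂ (proj₂ (proj₂ F-forest))

  Λ-mono : ∀ {a b} → a ≤[ F ] b → Λ F a ⊆ Λ F b
  Λ-mono {a} {b} a≤b x∈ = ∈-Λ⁺ F (transB _ a b (∈-Λ⁻ F x∈) a≤b)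

  Λ-injective : ∀ a b → Λ F a ≡ Λ F b → a ≡ b
  Λ-injective a b e = antisymB a b (∈-Λ⁻ F (subst (a ∈_) e (∈-Λ⁺ F (reflB a))))
                                   (∈-Λ⁻ F (subst (b ∈_) (sym e) (∈-Λ⁺ F (reflB b))))

  -- For incomparable a and b a common element would make the union connected.
  Λ-laminar : ∀ a b → ¬ IntersectNontrivially (Λ F a) (Λ F b)
  Λ-laminar a b ((k , k∈) , Λa⊈Λb , Λb⊈Λa) with T? (F a b) | T? (F b a)
  ... | yes a≤b | _ = Λa⊈Λb (Λ-mono a≤b)
  ... | no _ | yes b≤a = Λb⊈Λa (Λ-mono b≤a)
  ... | no a≰b | no b≰a = proj₂ (incomparable-disconnected a b a≰b b≰a)
          (∪-connected (Λ F a) (Λ F b) k (proj₂ (Λ-conn-ideal a)) (proj₂ (Λ-conn-ideal b))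
                       (proj₁ (x∈p∩q⁻ _ _ k∈)) (proj₂ (x∈p∩q⁻ _ _ k∈)))

  vertices : VertexSet P
  vertices = ΛFamily F , λ J J∈ → subst (IsConnIdeal P) (proj₂ (∈-ΛFamily⁻ F J∈)) (Λ-conn-ideal _)

  independent : IsIndependent P vertices
  independent A B A∈ B∈ with ∈-ΛFamily⁻ F A∈ | ∈-ΛFamily⁻ F B∈
  ... | a , refl | b , refl = Λ-laminar a b

  open Laminar P vertices independent using (NewIn; CoveredIn)

  Λ-new : ∀ i → NewIn i (Λ F i)
  Λ-new i = ∈-Λ⁺ F (reflB i) , uncovered
    where
    uncovered : ¬ CoveredIn (Λ F i) i
    uncovered (K , (K∈ , K⊂Λi) , i∈K) with ∈-ΛFamily⁻ F K∈
    ... | j , refl with antisymB i j (∈-Λ⁻ F i∈K) (∈-Λ⁻ F (proj₁ K⊂Λi (∈-Λ⁺ F (reflB j))))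
    ...   | refl = let (_ , y∈Λi , y∉Λi) = proj₂ K⊂Λi in y∉Λi y∈Λi

  maximum : IsMaximumIndependent P vertices
  maximum = independent , λ V V-indep →
    ≤-trans (Laminar.card≤n P V V-indep)
            (injective-≤-card (ΛFamily F) (Λ F) (∈-ΛFamily⁺ F) Λ-injective)

ΛFamily-injective : ∀ {n} (P : Poset n) {F G} → IsPForest P F → IsPForest P G →
                    (∀ J → ΛFamily F J ≡ ΛFamily G J) → ∀ i j → F i j ≡ G i j
ΛFamily-injective P {F} {G} F-forest G-forest same i j =
  T-injective (λ i≤Fj → ∈-Λ⁻ G (subst (i ∈_) ΛFj≡ΛGj (∈-Λ⁺ F i≤Fj)))
              (λ i≤Gj → ∈-Λ⁻ F (subst (i ∈_) (sym ΛFj≡ΛGj) (∈-Λ⁺ G i≤Gj)))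
  where
  open Laminar P (Forest.vertices P F F-forest) (Forest.independent P F F-forest)
    using (NewIn; new-unique)
  -- Both Λ F j and Λ G j are the member of the common family in which j is new.
  j-new-in-ΛGj : NewIn j (Λ G j)
  j-new-in-ΛGj with Forest.Λ-new P G G-forest j
  ... | j∈ , uncovered =
    j∈ , λ (K , (K∈ , K⊂) , j∈K) → uncovered (K , (subst T (same K) K∈ , K⊂) , j∈K)
  ΛFj≡ΛGj : Λ F j ≡ Λ G j
  ΛFj≡ΛGj = new-unique j (Λ F j) (Λ G j)
              (∈-ΛFamily⁺ F j) (subst T (sym (same (Λ G j))) (∈-ΛFamily⁺ G j))
              (Forest.Λ-new P F F-forest j) j-new-in-ΛGj

module Components {n : ℕ} (P : Poset n) where

  open Poset P using (le)
  open IsPartialOrderB (Poset.isPO P)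
  open Hasse P

  _<?_ : ∀ a b → Dec (a <[ le ] b)
  a <? b = T? (le a b) ×-dec ¬? (a ≟ᶠ b)

  _⋖?_ : ∀ a b → Dec (a ⋖[ le ] b)
  a ⋖? b = (a <? b) ×-dec all? (λ k → ¬? ((a <? k) ×-dec (k <? b)))

  adjacent? : ∀ a b → Dec (a ⋖[ le ] b ⊎ b ⋖[ le ] a)
  adjacent? a b = (a ⋖? b) ⊎-dec (b ⋖? a)

  height : Fin n → ℕ
  height a = ∣ Λ le a ∣

  height-mono : ∀ {a b} → a <[ le ] b → height a < height b
  height-mono {a} {b} (a≤b , a≢b) = p⊂q⇒∣p∣<∣q∣
    ( (λ x∈ → ∈-Λ⁺ le (transB _ a b (∈-Λ⁻ le x∈) a≤b))
    , b , ∈-Λ⁺ le (reflB b) , λ b∈ → a≢b (antisymB a b a≤b (∈-Λ⁻ le b∈)))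

  maximal-element : ∀ I {x} → x ∈ I → ∃ λ m → m ∈ I × (∀ y → y ∈ I → ¬ m <[ le ] y)
  maximal-element I {x} x∈I with argmax-over (allFin n) ∈-allFin (_∈? I) height (x , x∈I)
  ... | m , m∈I , highest = m , m∈I , λ y y∈I m<y → <⇒≱ (height-mono m<y) (highest y y∈I)

  -- An element w with y ≤ w < x of largest height is covered by x.
  cover-above : ∀ {y x} → y <[ le ] x → ∃ λ w → y ≤[ le ] w × w ⋖[ le ] x
  cover-above {y} {x} y<x
    with argmax-over (allFin n) ∈-allFin (λ w → T? (le y w) ×-dec (w <? x)) height (y , reflB y , y<x)
  ... | w , (y≤w , w<x) , highest =
    w , y≤w , w<x , λ k (w<k , k<x) →
      <⇒≱ (height-mono w<k) (highest k (transB y w k y≤w (proj₁ w<k) , k<x))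

  upward-path : ∀ {I} → IsOrderIdeal P I → ∀ {x y} → x ∈ I → y ≤[ le ] x → PathIn P I y x
  upward-path {I} I-ideal = go _ ≤-refl
    where
    go : ∀ k {x y} → height x < k → x ∈ I → y ≤[ le ] x → PathIn P I y x
    go (suc k) {x} {y} hx<k x∈I y≤x with y ≟ᶠ x
    ... | yes refl = here x∈I
    ... | no y≢x with cover-above (y≤x , y≢x)
    ...   | w , y≤w , w⋖x@(w<x@(w≤x , _) , _) =
      step (go k (<-≤-trans (height-mono w<x) (≤-pred hx<k)) (I-ideal x w x∈I w≤x) y≤w)
           x∈I (inj₁ w⋖x)

  -- The connected component of m in the Hasse diagram restricted to I, computed as
  -- the first fixed point of "add all neighbours inside I" starting from {m}.
  module Component (I : Subset n) (m : Fin n) (m∈I : m ∈ I) where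

    grow : Subset n → Subset n
    grow R = R ∪ select (λ j → (j ∈? I) ×-dec any? (λ k → (k ∈? R) ×-dec adjacent? k j))

    reach : ℕ → Subset n
    reach zero    = ⁅ m ⁆
    reach (suc k) = grow (reach k)

    reach-grows : ∀ k → (∃ λ j → reach j ≡ reach (suc j)) ⊎ suc k ≤ ∣ reach k ∣
    reach-grows zero = inj₂ (≤-reflexive (sym (∣⁅x⁆∣≡1 m)))
    reach-grows (suc k) with reach-grows k | reach k ≟ˢ reach (suc k)
    ... | inj₁ fixed | _ = inj₁ fixed
    ... | inj₂ _ | yes fixed = inj₁ (k , fixed)
    ... | inj₂ big | no moved = inj₂ (≤-trans (s≤s big) (p⊂q⇒∣p∣<∣q∣ (p⊆p∪q _ , ⊈⇒∃∉ grown⊈)))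
      where
      grown⊈ : ¬ (reach (suc k) ⊆ reach k)
      grown⊈ ⊆ = moved (⊆-antisym (p⊆p∪q _) ⊆)

    fixpoint : ∃ λ j → reach j ≡ reach (suc j)
    fixpoint with reach-grows n
    ... | inj₁ fixed = fixed
    ... | inj₂ big = ⊥-elim (<⇒≱ big (∣p∣≤n (reach n)))

    C : Subset n
    C = reach (proj₁ fixpoint)

    m∈reach : ∀ k → m ∈ reach k
    m∈reach zero    = x∈⁅x⁆ m
    m∈reach (suc k) = p⊆p∪q _ (m∈reach k)

    m∈C : m ∈ C
    m∈C = m∈reach (proj₁ fixpoint)

    reach-path : ∀ k {x} → x ∈ reach k → PathIn P I m x
    reach-path zero x∈ with x∈⁅y⁆⇒x≡y m x∈
    ... | refl = here m∈I
    reach-path (suc k) x∈ with x∈p∪q⁻ (reach k) _ x∈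
    ... | inj₁ x∈old = reach-path k x∈old
    ... | inj₂ x∈new with ∈-select⁻ _ x∈new
    ...   | x∈I , j , j∈ , adj = step (reach-path k j∈) x∈I adj

    C-path : ∀ {x} → x ∈ C → PathIn P I m x
    C-path = reach-path (proj₁ fixpoint)

    C⊆I : C ⊆ I
    C⊆I x∈ = path-end (C-path x∈)

    C-closed : ∀ {x y} → x ∈ C → y ∈ I → (x ⋖[ le ] y ⊎ y ⋖[ le ] x) → y ∈ C
    C-closed x∈ y∈I adj =
      subst (_ ∈_) (sym (proj₂ fixpoint)) (x∈p∪q⁺ (inj₂ (∈-select⁺ _ (y∈I , _ , x∈ , adj))))

    path-ends-in-C : ∀ {x} → PathIn P I m x → x ∈ C
    path-ends-in-C (here _)          = m∈C
    path-ends-in-C (step p y∈I adj) = C-closed (path-ends-in-C p) y∈I adj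

    path-restrict : ∀ {x} → PathIn P I m x → PathIn P C m x
    path-restrict (here _)            = here m∈C
    path-restrict p@(step q _ adj) = step (path-restrict q) (path-ends-in-C p) adj

    C-connected : IsConnectedSet P C
    C-connected = (m , m∈C) , λ i j i∈ j∈ →
      path-reverse (path-restrict (C-path i∈)) ++ᵖ path-restrict (C-path j∈)

    C-ideal : IsOrderIdeal P I → IsOrderIdeal P C
    C-ideal I-ideal i j i∈ j≤i =
      path-ends-in-C (C-path i∈ ++ᵖ path-reverse (upward-path I-ideal (C⊆I i∈) j≤i))

    connected-meeting-C⊆C : ∀ {K x} → K ⊆ I → IsConnectedSet P K → x ∈ K → x ∈ C → K ⊆ C
    connected-meeting-C⊆C K⊆I (_ , K-conn) x∈K x∈C y∈K =
      path-ends-in-C (C-path x∈C ++ᵖ path-mono K⊆I (K-conn _ _ x∈K y∈K))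

module LargeIndependentSet {n : ℕ} (P : Poset n) where

  open Poset P using (le)
  open Components P

  -- The injective labels witness that the family has at least ∣ I ∣ members.
  record LabelledFamily (I : Subset n) : Set where
    field
      S                 : Subset n → Bool
      member-conn-ideal : ∀ J → T (S J) → IsConnIdeal P J
      member⊆I          : ∀ J → T (S J) → J ⊆ I
      independent       : ∀ A B → T (S A) → T (S B) → ¬ IntersectNontrivially A B
      label             : Fin n → Subset n
      label∈S           : ∀ x → x ∈ I → T (S (label x))
      label-injective   : ∀ x y → x ∈ I → y ∈ I → label x ≡ label y → x ≡ y

  empty-family : ∀ {I} → ¬ Nonempty I → LabelledFamily I
  empty-family {I} I=∅ = record
    { S = λ _ → false ; member-conn-ideal = λ _ () ; member⊆I = λ _ () ; independent = λ _ _ ()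
    ; label = λ _ → I ; label∈S = λ x x∈ → ⊥-elim (I=∅ (x , x∈))
    ; label-injective = λ x _ x∈ _ _ → ⊥-elim (I=∅ (x , x∈)) }

  _without_ : Subset n → Fin n → Subset n
  I without m = select (λ y → (y ∈? I) ×-dec ¬? (y ≟ᶠ m))

  without⊆ : ∀ {I m} → I without m ⊆ I
  without⊆ y∈ = proj₁ (∈-select⁻ _ y∈)

  ∉without : ∀ {I m} → m ∉ I without m
  ∉without m∈ = proj₂ (∈-select⁻ _ m∈) refl

  without-ideal : ∀ {I m} → IsOrderIdeal P I → (∀ y → y ∈ I → ¬ m <[ le ] y) →
                  IsOrderIdeal P (I without m)
  without-ideal {I} {m} I-ideal m-maximal i j i∈ j≤i =
    ∈-select⁺ _ (I-ideal i j (without⊆ i∈) j≤i , j≢m)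
    where
    j≢m : j ≢ m
    j≢m refl = m-maximal i (without⊆ i∈) (j≤i , λ m≡i → proj₂ (∈-select⁻ _ i∈) (sym m≡i))

  -- Adding the component C of a maximal element m keeps the family laminar:
  -- every older member is connected and inside I, so it lies in C or misses it.
  add-component : ∀ {I m} → IsOrderIdeal P I → m ∈ I → LabelledFamily (I without m) →
                  LabelledFamily I
  add-component {I} {m} I-ideal m∈I old = record
    { S = S ; member-conn-ideal = member-conn-ideal ; member⊆I = member⊆I ; independent = independent
    ; label = label ; label∈S = label∈S ; label-injective = label-injective }
    where
    module Old = LabelledFamily old
    open Component I m m∈I
    S : Subset n → Bool
    S J = Old.S J ∨ ⌊ J ≟ˢ C ⌋
    member-cases : ∀ {J} → T (S J) → T (Old.S J) ⊎ J ≡ C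
    member-cases {J} J∈ with Equivalence.to (T-∨ {Old.S J}) J∈
    ... | inj₁ J∈old = inj₁ J∈old
    ... | inj₂ J≡C   = inj₂ (toWitness J≡C)
    old∈S : ∀ {J} → T (Old.S J) → T (S J)
    old∈S J∈ = Equivalence.from T-∨ (inj₁ J∈)
    C∈S : T (S C)
    C∈S = Equivalence.from (T-∨ {Old.S C}) (inj₂ (fromWitness refl))
    old⊆I : ∀ {K} → T (Old.S K) → K ⊆ I
    old⊆I K∈ x∈ = without⊆ (Old.member⊆I _ K∈ x∈)
    member-conn-ideal : ∀ J → T (S J) → IsConnIdeal P J
    member-conn-ideal J J∈ with member-cases J∈
    ... | inj₁ J∈old = Old.member-conn-ideal J J∈old
    ... | inj₂ refl  = C-ideal I-ideal , C-connected
    member⊆I : ∀ J → T (S J) → J ⊆ I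
    member⊆I J J∈ with member-cases J∈
    ... | inj₁ J∈old = old⊆I J∈old
    ... | inj₂ refl  = C⊆I
    old-meeting-C⊆C : ∀ {K x} → T (Old.S K) → x ∈ K → x ∈ C → K ⊆ C
    old-meeting-C⊆C K∈ = connected-meeting-C⊆C (old⊆I K∈) (proj₂ (Old.member-conn-ideal _ K∈))
    independent : ∀ A B → T (S A) → T (S B) → ¬ IntersectNontrivially A B
    independent A B A∈ B∈ with member-cases A∈ | member-cases B∈
    ... | inj₁ A∈old | inj₁ B∈old = Old.independent A B A∈old B∈old
    ... | inj₂ refl  | inj₂ refl  = λ (_ , C⊈C , _) → C⊈C ⊆-refl
    ... | inj₂ refl  | inj₁ B∈old = λ ((x , x∈) , _ , B⊈C) →
      B⊈C (old-meeting-C⊆C B∈old (proj₂ (x∈p∩q⁻ C B x∈)) (proj₁ (x∈p∩q⁻ C B x∈)))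
    ... | inj₁ A∈old | inj₂ refl  = λ ((x , x∈) , A⊈C , _) →
      A⊈C (old-meeting-C⊆C A∈old (proj₁ (x∈p∩q⁻ A C x∈)) (proj₂ (x∈p∩q⁻ A C x∈)))
    label : Fin n → Subset n
    label y with y ≟ᶠ m
    ... | yes _ = C
    ... | no  _ = Old.label y
    old-label∈ : ∀ {y} → y ∈ I → y ≢ m → T (Old.S (Old.label y))
    old-label∈ y∈I y≢m = Old.label∈S _ (∈-select⁺ _ (y∈I , y≢m))
    label∈S : ∀ y → y ∈ I → T (S (label y))
    label∈S y y∈I with y ≟ᶠ m
    ... | yes _   = C∈S
    ... | no  y≢m = old∈S (old-label∈ y∈I y≢m)
    C≢old-label : ∀ {y} → y ∈ I → y ≢ m → C ≢ Old.label y
    C≢old-label y∈I y≢m C≡ =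
      ∉without (Old.member⊆I _ (old-label∈ y∈I y≢m) (subst (m ∈_) C≡ m∈C))
    label-injective : ∀ x y → x ∈ I → y ∈ I → label x ≡ label y → x ≡ y
    label-injective x y x∈I y∈I e with x ≟ᶠ m | y ≟ᶠ m
    ... | yes refl | yes refl = refl
    ... | yes refl | no  y≢m = ⊥-elim (C≢old-label y∈I y≢m e)
    ... | no  x≢m | yes refl = ⊥-elim (C≢old-label x∈I x≢m (sym e))
    ... | no  x≢m | no  y≢m =
      Old.label-injective x y (∈-select⁺ _ (x∈I , x≢m)) (∈-select⁺ _ (y∈I , y≢m)) e

  labelled-family : ∀ k I → IsOrderIdeal P I → ∣ I ∣ < k → LabelledFamily I
  labelled-family (suc k) I I-ideal ∣I∣<k with nonempty? I
  ... | no I=∅ = empty-family I=∅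
  ... | yes (x , x∈I) with maximal-element I x∈I
  ...   | m , m∈I , m-maximal =
    add-component I-ideal m∈I
      (labelled-family k (I without m) (without-ideal I-ideal m-maximal)
         (<-≤-trans (p⊂q⇒∣p∣<∣q∣ (without⊆ , m , m∈I , ∉without)) (≤-pred ∣I∣<k)))

  large-independent-set : Σ (VertexSet P) λ V → IsIndependent P V × n ≤ card (proj₁ V)
  large-independent-set =
    (S , member-conn-ideal) , independent ,
    injective-≤-card S label (λ x → label∈S x ∈⊤) (λ x y → label-injective x y ∈⊤ ∈⊤)
    where open LabelledFamily (labelled-family (suc n) ⊤ (λ _ _ _ _ → ∈⊤) (s≤s (∣p∣≤n ⊤)))

  maximum⇒n≤card : ∀ V → IsMaximumIndependent P V → n ≤ card (proj₁ V)
  maximum⇒n≤card V (_ , maximum) = ≤-trans n≤card (maximum W W-independent)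
    where
    W = proj₁ large-independent-set
    W-independent = proj₁ (proj₂ large-independent-set)
    n≤card = proj₂ (proj₂ large-independent-set)

module ForestOfFamily {n : ℕ} (P : Poset n) (V : VertexSet P) (indep : IsIndependent P V)
                      (large : n ≤ card (proj₁ V)) where

  open Hasse P
  open Laminar P V indep

  Labels : Fin n → Subset n → Set
  Labels x J = Σ (T (S J)) λ J∈ → new J J∈ ≡ x

  labels? : ∀ x J → Dec (Labels x J)
  labels? x J with T? (S J)
  ... | no J∉ = no (J∉ ∘ proj₁)
  ... | yes J∈ with new J J∈ ≟ᶠ x
  ...   | yes e = yes (J∈ , e)
  ...   | no ne = no λ (J∈′ , e) → ne (subst (λ J∈ → new J J∈ ≡ x) (T-irrelevant J∈′ J∈) e)

  -- With n members and injective new elements, every element is hit (pigeonhole).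
  labelled : ∀ x → ∃ (Labels x)
  labelled x with anySubset? (labels? x)
  ... | yes found = found
  ... | no ∄ = ⊥-elim (<⇒≱ (card-injective-< S x new new-injective λ J J∈ e → ∄ (J , J∈ , e)) large)

  label : Fin n → Subset n
  label x = proj₁ (labelled x)

  label∈S : ∀ x → T (S (label x))
  label∈S x = proj₁ (proj₂ (labelled x))

  new-label : ∀ x → new (label x) (label∈S x) ≡ x
  new-label x = proj₂ (proj₂ (labelled x))

  new-in-label : ∀ x → NewIn x (label x)
  new-in-label x = subst (λ y → NewIn y (label x)) (new-label x) (proj₂ (new-exists _ (label∈S x)))

  ∈label : ∀ x → x ∈ label x
  ∈label x = proj₁ (new-in-label x)

  label-injective : ∀ i j → label i ≡ label j → i ≡ j
  label-injective i j e = begin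
    i                               ≡⟨ sym (new-label i) ⟩
    new (label i) (label∈S i)       ≡⟨ new-cong e (label∈S i) (label∈S j) ⟩
    new (label j) (label∈S j)       ≡⟨ new-label j ⟩
    j                               ∎
    where
    open ≡-Reasoning
    new-cong : ∀ {J K} → J ≡ K → (J∈ : T (S J)) (K∈ : T (S K)) → new J J∈ ≡ new K K∈
    new-cong refl J∈ K∈ = cong (new _) (T-irrelevant J∈ K∈)

  label-⊆ : ∀ {y} j → y ∈ label j → label y ⊆ label j
  label-⊆ {y} j y∈ with laminar (label y) (label j) (label∈S y) (label∈S j)
  ... | inj₁ disjoint = ⊥-elim (disjoint y (∈label y) y∈)
  ... | inj₂ (inj₁ ⊆) = ⊆
  ... | inj₂ (inj₂ ⊇) with ⊆⇒≡⊎⊂ ⊇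
  ...   | inj₁ j≡y = ⊆-reflexive (sym j≡y)
  ...   | inj₂ ⊂ = ⊥-elim (proj₂ (new-in-label y) (label j , (label∈S j , ⊂) , y∈))

  F : Fin n → Fin n → Bool
  F i j = ⌊ label i ⊆? label j ⌋

  ≤F⁺ : ∀ {i j} → label i ⊆ label j → i ≤[ F ] j
  ≤F⁺ ⊆ = fromWitness (λ {x} → ⊆ {x})

  ≤F⁻ : ∀ {i j} → i ≤[ F ] j → label i ⊆ label j
  ≤F⁻ i≤j {x} = toWitness i≤j {x}

  Λ≡label : ∀ j → Λ F j ≡ label j
  Λ≡label j = ⊆-antisym (λ y∈ → ≤F⁻ (∈-Λ⁻ F y∈) (∈label _)) (λ y∈ → ∈-Λ⁺ F (≤F⁺ (label-⊆ j y∈)))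

  F-partial-order : IsPartialOrderB F
  F-partial-order = record
    { reflB    = λ _ → ≤F⁺ ⊆-refl
    ; antisymB = λ i j i≤j j≤i → label-injective i j (⊆-antisym (≤F⁻ i≤j) (≤F⁻ j≤i))
    ; transB   = λ _ _ _ i≤j j≤k → ≤F⁺ (⊆-trans (≤F⁻ i≤j) (≤F⁻ j≤k)) }

  -- Two upper covers of i both contain i, so are nested, and then one is not a cover.
  F-forest : ∀ i j k → i ⋖[ F ] j → i ⋖[ F ] k → j ≡ k
  F-forest i j k (i<j , j-cover) (i<k , k-cover) with j ≟ᶠ k
  ... | yes j≡k = j≡k
  ... | no j≢k with laminar (label j) (label k) (label∈S j) (label∈S k)
  ...   | inj₁ disjoint = ⊥-elim (disjoint i (≤F⁻ (proj₁ i<j) (∈label i)) (≤F⁻ (proj₁ i<k) (∈label i)))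
  ...   | inj₂ (inj₁ j⊆k) = ⊥-elim (k-cover j (i<j , ≤F⁺ j⊆k , j≢k))
  ...   | inj₂ (inj₂ k⊆j) = ⊥-elim (j-cover k (i<k , ≤F⁺ k⊆j , j≢k ∘ sym))

  F-conn-ideal : ∀ i → IsConnIdeal P (Λ F i)
  F-conn-ideal i = subst (IsConnIdeal P) (sym (Λ≡label i)) (member-conn-ideal _ (label∈S i))

  F-incomparable-disconnected : ∀ i j → ¬ i ≤[ F ] j → ¬ j ≤[ F ] i →
                                IsDisconnIdeal P (Λ F i ∪ Λ F j)
  F-incomparable-disconnected i j i≰j j≰i =
    subst (IsDisconnIdeal P) (sym (cong₂ _∪_ (Λ≡label i) (Λ≡label j)))
      ( ∪-ideal (label i) (label j) (ideal i) (ideal j)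
      , disjoint-ideals-disconnected (label i) (label j) (ideal i) (ideal j) disjoint
          (i , ∈label i) (j , ∈label j))
    where
    ideal : ∀ x → IsOrderIdeal P (label x)
    ideal x = proj₁ (member-conn-ideal _ (label∈S x))
    disjoint : Disjoint (label i) (label j)
    disjoint with laminar (label i) (label j) (label∈S i) (label∈S j)
    ... | inj₁ i∩j=∅ = i∩j=∅
    ... | inj₂ (inj₁ i⊆j) = ⊥-elim (i≰j (≤F⁺ i⊆j))
    ... | inj₂ (inj₂ j⊆i) = ⊥-elim (j≰i (≤F⁺ j⊆i))

  F-is-P-forest : IsPForest P F
  F-is-P-forest = F-partial-order , F-forest , F-conn-ideal , F-incomparable-disconnected

  ΛFamily≡S : ∀ J → ΛFamily F J ≡ S J
  ΛFamily≡S J = T-injective to from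
    where
    to : T (ΛFamily F J) → T (S J)
    to J∈ with ∈-ΛFamily⁻ F J∈
    ... | i , refl = subst (T ∘ S) (sym (Λ≡label i)) (label∈S i)
    from : T (S J) → T (ΛFamily F J)
    from J∈ = subst (T ∘ ΛFamily F) Λx≡J (∈-ΛFamily⁺ F x)
      where
      x = new J J∈
      Λx≡J : Λ F x ≡ J
      Λx≡J = trans (Λ≡label x)
                   (new-unique x (label x) J (label∈S x) J∈ (new-in-label x) (proj₂ (new-exists J J∈)))

theorem1p1 : (n : ℕ) (P : Poset n) → Bijection (PForestSetoid P) (MaxIndepSetoid P)
theorem1p1 n P = record
  { to        = λ (F , F-forest) → Forest.vertices P F F-forest , Forest.maximum P F F-forest
  ; cong      = ΛFamily-cong
  ; bijective = (λ {(_ , F-forest)} {(_ , G-forest)} → ΛFamily-injective P F-forest G-forest)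
              , λ (V , V-maximum@(V-independent , _)) →
                  let open ForestOfFamily P V V-independent
                                          (LargeIndependentSet.maximum⇒n≤card P V V-maximum)
                  in (F , F-is-P-forest) , λ G≈F J → trans (ΛFamily-cong G≈F J) (ΛFamily≡S J)
  }
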